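{- Let $A$ be a totally filled $n\times m$ toroidal array, i.e. every cell is filled. Then $P(A)$ has a solution if and only if $n$ and $m$ are not both even.
   Context: Arrays are toroidal: an $n\times m$ array $A$ has rows indexed modulo $n$ and columns modulo $m$ (representatives $1,\dots,n$ and $1,\dots,m$). Each cell is either filled or empty, and $F(A)$ is the set of filled cells. For $(i,j)\in F(A)$: - the row successor $s_r((i,j))$ is $(i,j+k)$ with $k\ge1$ minimal such that $(i,j+k)\in F(A)$; - the column successor $s_c((i,j))$ is $(i+k,j)$ with $k\ge1$ minimal such that $(i+k,j)\in F(A)$. Given $R=(r_1,\dots,r_n)\in\{ -1,1\}^n$ and $C=(c_1,\dots,c_m)\in\{ -1,1\}^m$, the move function is $S_{R,C}((i,j))=s_c^{\,c_{j'}}((i,j'))$, where $(i,j')=s_r^{\,r_i}((i,j))$; exponent $-1$ denotes the inverse permutation. $R,C$ is a solution of $P(A)$ if $S_{R,C}$ is a single cycle on $F(A)$, i.e. starting at any filled cell and iterating $S_{R,C}$ visits every filled cell. $P(A)$ has a solution if such $R,C$ exist. For a totally filled array, $S_{R,C}((i,j))=(i+c_{j+r_i},\,j+r_i)$. -}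

module Defs where

open import Data.Nat using (ℕ; zero; suc; _+_; _∸_; NonZero)
open import Data.Nat.DivMod using (_mod_)
open import Data.Fin using (Fin; toℕ)
open import Data.Bool using (Bool; true; false; if_then_else_)
open import Data.Sign using (Sign)
open import Data.Product using (_×_; _,_; ∃)
open import Function using (_∘_)
open import Relation.Binary.PropositionalEquality using (_≡_)

-- An n × m toroidal array: each cell is filled (true) or empty (false).
-- Rows are indexed by Fin n (representing ℤ/nℤ), columns by Fin m.
Array : ℕ → ℕ → Set
Array n m = Fin n → Fin m → Bool

Cell : ℕ → ℕ → Set
Cell n m = Fin n × Fin m

Filled : ∀ {n m} → Array n m → Cell n m → Set
Filled A (i , j) = A i j ≡ true

TotallyFilled : ∀ {n m} → Array n m → Set
TotallyFilled A = ∀ i j → A i j ≡ true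

shift+ : ∀ {m} .{{_ : NonZero m}} → Fin m → ℕ → Fin m
shift+ {m} j k = (toℕ j + k) mod m

shift- : ∀ {m} .{{_ : NonZero m}} → Fin m → ℕ → Fin m
shift- {m} j k = (toℕ j + (m ∸ toℕ (k mod m))) mod m

-- least k ∈ {k₀, …, k₀ + fuel - 1} with p k = true; default k₀ + fuel - 1.
-- (On a filled cell, k = size always succeeds, so the default is never wrong.)
firstK : (ℕ → Bool) → ℕ → ℕ → ℕ
firstK p k zero = k
firstK p k (suc zero) = k
firstK p k (suc (suc f)) = if p k then k else firstK p (suc k) (suc f)

-- the minimal k ≥ 1 (searching k = 1, …, size) such that the cell reached is filled
-- row successor / predecessor (= inverse of the row successor on filled cells)
rowSucc : ∀ {n m} .{{_ : NonZero m}} → Array n m → Cell n m → Cell n m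
rowSucc {m = m} A (i , j) = i , shift+ j (firstK (λ k → A i (shift+ j k)) 1 m)

rowPred : ∀ {n m} .{{_ : NonZero m}} → Array n m → Cell n m → Cell n m
rowPred {m = m} A (i , j) = i , shift- j (firstK (λ k → A i (shift- j k)) 1 m)

colSucc : ∀ {n m} .{{_ : NonZero n}} → Array n m → Cell n m → Cell n m
colSucc {n = n} A (i , j) = shift+ i (firstK (λ k → A (shift+ i k) j) 1 n) , j

colPred : ∀ {n m} .{{_ : NonZero n}} → Array n m → Cell n m → Cell n m
colPred {n = n} A (i , j) = shift- i (firstK (λ k → A (shift- i k) j) 1 n) , j

rowPow : ∀ {n m} .{{_ : NonZero m}} → Array n m → Sign → Cell n m → Cell n m
rowPow A Sign.+ = rowSucc A
rowPow A Sign.- = rowPred A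

colPow : ∀ {n m} .{{_ : NonZero n}} → Array n m → Sign → Cell n m → Cell n m
colPow A Sign.+ = colSucc A
colPow A Sign.- = colPred A

move : ∀ {n m} .{{_ : NonZero n}} .{{_ : NonZero m}} → Array n m →
       (Fin n → Sign) → (Fin m → Sign) → Cell n m → Cell n m
move A R C (i , j) with rowPow A (R i) (i , j)
... | (i' , j') = colPow A (C j') (i' , j')

iter : ∀ {X : Set} → (X → X) → ℕ → X → X
iter f zero x = x
iter f (suc t) x = f (iter f t x)

IsSolution : ∀ {n m} .{{_ : NonZero n}} .{{_ : NonZero m}} → Array n m →
             (Fin n → Sign) → (Fin m → Sign) → Set
IsSolution A R C = ∀ x y → Filled A x → Filled A y →
                   ∃ λ t → iter (move A R C) t x ≡ y

HasSolution : ∀ {n m} .{{_ : NonZero n}} .{{_ : NonZero m}} → Array n m → Set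
HasSolution {n} {m} A = ∃ λ (R : Fin n → Sign) → ∃ λ (C : Fin m → Sign) → IsSolution A R C

-- In a totally filled array every row/column successor is a unit shift, so the
-- move function is (i , j) ↦ (i + C (j + R i) , j + R i) with signs R, C.
--
-- If 2 ∣ n and 2 ∣ m, a unit shift flips the parity
-- of its coordinate, so each move preserves the colour (i + j) mod 2 of a cell
-- (chessboard colouring).  Hence (i , j) never reaches (i , j + 1).
--
-- Say n is odd (the case m odd is the transpose).  Take
-- C ≡ +1 and R i = (-1)^i.  The move then follows the "zigzag"
-- (r mod n , (k + r mod 2) mod m), r = 0, 1, …: the row advances by one while
-- the column alternates between two neighbours.  After n (odd) moves the
-- column offset has advanced by one, so the walk sweeps through k = 0 … m - 1
-- and visits every cell before returning to the start.  A general "grid walk"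
-- lemma turns such a walk into the statement that the move is a single cycle.
module Submission where

open import Defs
open import Data.Nat using (ℕ; zero; suc; _+_; _*_; _∸_; _%_; _≤_; _<_; NonZero; z≤n; >-nonZero⁻¹; s≤s⁻¹)
open import Data.Nat.Properties
open import Data.Nat.DivMod
open import Data.Nat.Divisibility using (_∣_; m%n≡0⇒n∣m; n∣m⇒m%n≡0; ∣m+n∣m⇒∣n; ∣-refl)
open import Data.Fin using (Fin; toℕ; zero)
open import Data.Fin.Properties using (toℕ-injective; toℕ-fromℕ<; toℕ<n)
open import Data.Sign using (Sign)
open import Data.Bool using (Bool; true)
open import Data.Empty using (⊥-elim)
open import Relation.Nullary using (¬_)
open import Data.Product using (_×_; _,_; ∃; swap)
open import Data.Sum using (_⊎_; inj₁; inj₂)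
open import Function.Bundles using (_⇔_; mk⇔)
open import Relation.Binary.PropositionalEquality

toℕ-mod : ∀ a N .{{_ : NonZero N}} → toℕ (a mod N) ≡ a % N
toℕ-mod a N = toℕ-fromℕ< (m%n<n a N)

toℕ-mod-< : ∀ {a N} .{{_ : NonZero N}} → a < N → toℕ (a mod N) ≡ a
toℕ-mod-< {a} {N} a<N = trans (toℕ-mod a N) (m<n⇒m%n≡m a<N)

mod-cong : ∀ {a b N} .{{_ : NonZero N}} → a % N ≡ b % N → a mod N ≡ b mod N
mod-cong {a} {b} {N} e = toℕ-injective (trans (toℕ-mod a N) (trans e (sym (toℕ-mod b N))))

mod-toℕ : ∀ {N} .{{_ : NonZero N}} (a : Fin N) → toℕ a mod N ≡ a
mod-toℕ {N} a = toℕ-injective (toℕ-mod-< (toℕ<n a))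

mod-self : ∀ N .{{_ : NonZero N}} → N mod N ≡ 0 mod N
mod-self N = mod-cong (trans (n%n≡0 N) (sym (m<n⇒m%n≡m (>-nonZero⁻¹ N))))

%-reduceˡ : ∀ a b N .{{_ : NonZero N}} → (a % N + b) % N ≡ (a + b) % N
%-reduceˡ a b N = begin
  (a % N + b) % N           ≡⟨ %-distribˡ-+ (a % N) b N ⟩
  (a % N % N + b % N) % N   ≡⟨ cong (λ z → (z + b % N) % N) (m%n%n≡m%n a N) ⟩
  (a % N + b % N) % N       ≡⟨ %-distribˡ-+ a b N ⟨
  (a + b) % N               ∎
  where open ≡-Reasoning

mod-onto : ∀ N .{{_ : NonZero N}} (b : Fin N) c → c ≤ N → ∃ λ k → k < N × (k + c) mod N ≡ b
mod-onto N b c c≤N = k , m%n<n _ N , trans (mod-cong hit) (mod-toℕ b)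
  where
  open ≡-Reasoning
  k = (toℕ b + (N ∸ c)) % N
  hit : (k + c) % N ≡ toℕ b % N
  hit = begin
    (k + c) % N                   ≡⟨ %-reduceˡ (toℕ b + (N ∸ c)) c N ⟩
    (toℕ b + (N ∸ c) + c) % N     ≡⟨ cong (_% N) (+-assoc (toℕ b) (N ∸ c) c) ⟩
    (toℕ b + ((N ∸ c) + c)) % N   ≡⟨ cong (λ z → (toℕ b + z) % N) (m∸n+n≡m c≤N) ⟩
    (toℕ b + N) % N               ≡⟨ [m+n]%n≡m%n (toℕ b) N ⟩
    toℕ b % N                     ∎

-- The unit shift j ↦ j ± 1 (these are the successors in a totally filled array).
step : ∀ {N} .{{_ : NonZero N}} → Sign → Fin N → Fin N
step Sign.+ j = shift+ j 1
step Sign.- j = shift- j 1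

step+-mod : ∀ a N .{{_ : NonZero N}} → step Sign.+ (a mod N) ≡ suc a mod N
step+-mod a N = mod-cong (begin
  (toℕ (a mod N) + 1) % N   ≡⟨ cong (λ z → (z + 1) % N) (toℕ-mod a N) ⟩
  (a % N + 1) % N           ≡⟨ %-reduceˡ a 1 N ⟩
  (a + 1) % N               ≡⟨ cong (_% N) (+-comm a 1) ⟩
  suc a % N                 ∎)
  where open ≡-Reasoning

step--mod : ∀ a N .{{_ : NonZero N}} → step Sign.- (suc a mod N) ≡ a mod N
step--mod a (suc zero) with suc a mod 1 | a mod 1
... | zero | zero = refl
step--mod a N@(suc (suc N-2)) = mod-cong {toℕ (suc a mod N) + (N ∸ toℕ (1 mod N))} {a} (begin
  (toℕ (suc a mod N) + suc N-2) % N   ≡⟨ cong (λ z → (z + suc N-2) % N) (toℕ-mod (suc a) N) ⟩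
  (suc a % N + suc N-2) % N           ≡⟨ %-reduceˡ (suc a) (suc N-2) N ⟩
  (suc a + suc N-2) % N               ≡⟨ cong (_% N) (+-suc a (suc N-2)) ⟨
  (a + N) % N                         ≡⟨ [m+n]%n≡m%n a N ⟩
  a % N                               ∎)
  where open ≡-Reasoning

step-parity : ∀ N .{{_ : NonZero N}} → 2 ∣ N → ∀ s (i : Fin N) →
              toℕ (step s i) % 2 ≡ suc (toℕ i) % 2
step-parity N 2∣N Sign.+ i = begin
  toℕ (shift+ i 1) % 2     ≡⟨ cong (_% 2) (toℕ-mod (toℕ i + 1) N) ⟩
  (toℕ i + 1) % N % 2      ≡⟨ m∣n⇒o%n%m≡o%m 2 N (toℕ i + 1) 2∣N ⟩
  (toℕ i + 1) % 2          ≡⟨ cong (_% 2) (+-comm (toℕ i) 1) ⟩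
  suc (toℕ i) % 2          ∎
  where open ≡-Reasoning
step-parity (suc zero) 2∣1 Sign.- i with () ← n∣m⇒m%n≡0 1 2 2∣1
step-parity N@(suc (suc N-2)) 2∣N Sign.- i = begin
  toℕ (shift- i 1) % 2           ≡⟨ cong (_% 2) (toℕ-mod (toℕ i + suc N-2) N) ⟩
  (toℕ i + suc N-2) % N % 2      ≡⟨ m∣n⇒o%n%m≡o%m 2 N (toℕ i + suc N-2) 2∣N ⟩
  (toℕ i + suc N-2) % 2          ≡⟨ cong (_% 2) (+-suc (toℕ i) N-2) ⟩
  (suc (toℕ i) + N-2) % 2        ≡⟨ %-remove-+ʳ (suc (toℕ i)) (∣m+n∣m⇒∣n 2∣N (∣-refl {2})) ⟩
  suc (toℕ i) % 2                ∎
  where open ≡-Reasoning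

parity : ∀ r → (r % 2 ≡ 0 × suc r % 2 ≡ 1) ⊎ (r % 2 ≡ 1 × suc r % 2 ≡ 0)
parity zero = inj₁ (refl , refl)
parity (suc zero) = inj₂ (refl , refl)
parity (suc (suc r)) = parity r

parity-flip : ∀ r → r % 2 ≢ suc r % 2
parity-flip r with parity r
... | inj₁ (e₀ , e₁) = λ e → 0≢1+n (trans (sym e₀) (trans e e₁))
... | inj₂ (e₁ , e₀) = λ e → 0≢1+n (trans (sym e₀) (trans (sym e) e₁))

-- The sign (-1)^r, read off from the residue r % 2.
alternate : ℕ → Sign
alternate zero = Sign.+
alternate (suc _) = Sign.-

-- Shifting by (-1)^r moves the offset k + r % 2 to k + (r + 1) % 2:
-- the zigzag between two neighbouring positions.
step-alternate : ∀ k r N .{{_ : NonZero N}} →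
                 step (alternate (r % 2)) ((k + r % 2) mod N) ≡ (k + suc r % 2) mod N
step-alternate k r N with parity r
... | inj₁ (e₀ , e₁) rewrite e₀ | e₁ =
  trans (cong (λ z → step Sign.+ (z mod N)) (+-identityʳ k))
        (trans (step+-mod k N) (cong (_mod N) (+-comm 1 k)))
... | inj₂ (e₁ , e₀) rewrite e₁ | e₀ =
  trans (cong (λ z → step Sign.- (z mod N)) (+-comm k 1))
        (trans (step--mod k N) (cong (_mod N) (sym (+-identityʳ k))))

firstK-hit : ∀ (p : ℕ → Bool) N → p 1 ≡ true → firstK p 1 N ≡ 1
firstK-hit p zero _ = refl
firstK-hit p (suc zero) _ = refl
firstK-hit p (suc (suc N)) p1 rewrite p1 = refl

module TotallyFilledMoves {n m : ℕ} .{{_ : NonZero n}} .{{_ : NonZero m}}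
                          (A : Array n m) (full : TotallyFilled A) where

  rowPow-full : ∀ s i j → rowPow A s (i , j) ≡ (i , step s j)
  rowPow-full Sign.+ i j = cong (λ k → i , shift+ j k) (firstK-hit _ m (full _ _))
  rowPow-full Sign.- i j = cong (λ k → i , shift- j k) (firstK-hit _ m (full _ _))

  colPow-full : ∀ s i j → colPow A s (i , j) ≡ (step s i , j)
  colPow-full Sign.+ i j = cong (λ k → shift+ i k , j) (firstK-hit _ n (full _ _))
  colPow-full Sign.- i j = cong (λ k → shift- i k , j) (firstK-hit _ n (full _ _))

  move-full : ∀ R C i j → move A R C (i , j) ≡ (step (C (step (R i) j)) i , step (R i) j)
  move-full R C i j with rowPow A (R i) (i , j) | rowPow-full (R i) i j
  ... | .(i , step (R i) j) | refl = colPow-full (C (step (R i) j)) i (step (R i) j)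

iter-+ : ∀ {X : Set} (f : X → X) a b x → iter f (a + b) x ≡ iter f a (iter f b x)
iter-+ f zero b x = refl
iter-+ f (suc a) b x = cong f (iter-+ f a b x)

single-cycle : ∀ {X : Set} (f : X → X) (o : X) N → iter f N o ≡ o →
               (∀ y → ∃ λ t → t < N × iter f t o ≡ y) → ∀ x y → ∃ λ t → iter f t x ≡ y
single-cycle f o N period onto x y with onto x | onto y
... | tx , tx<N , ex | ty , _ , ey = (ty + N) ∸ tx , (begin
  iter f (ty + N ∸ tx) x                ≡⟨ cong (iter f (ty + N ∸ tx)) ex ⟨
  iter f (ty + N ∸ tx) (iter f tx o)    ≡⟨ iter-+ f (ty + N ∸ tx) tx o ⟨
  iter f (ty + N ∸ tx + tx) o           ≡⟨ cong (λ t → iter f t o) (m∸n+n≡m tx≤ty+N) ⟩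
  iter f (ty + N) o                     ≡⟨ iter-+ f ty N o ⟩
  iter f ty (iter f N o)                ≡⟨ cong (iter f ty) period ⟩
  iter f ty o                           ≡⟨ ey ⟩
  y                                     ∎)
  where
  open ≡-Reasoning
  tx≤ty+N = ≤-trans (<⇒≤ tx<N) (m≤n+m N ty)

module GridWalk {X : Set} (f : X → X) (cell : ℕ → ℕ → X) (P Q : ℕ)
  (along : ∀ k r → r < Q → f (cell k r) ≡ cell k (suc r))
  (wrap : ∀ k → cell k Q ≡ cell (suc k) 0)
  (closed : cell P 0 ≡ cell 0 0)
  (covers : ∀ y → ∃ λ k → ∃ λ r → k < P × r < Q × cell k r ≡ y) where

  walk : ∀ k r → r ≤ Q → iter f (k * Q + r) (cell 0 0) ≡ cell k r
  walk zero zero _ = refl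
  walk (suc k) zero _ = begin
    iter f (Q + k * Q + 0) (cell 0 0)   ≡⟨ cong (λ t → iter f t (cell 0 0)) (trans (+-identityʳ _) (+-comm Q (k * Q))) ⟩
    iter f (k * Q + Q) (cell 0 0)       ≡⟨ walk k Q ≤-refl ⟩
    cell k Q                            ≡⟨ wrap k ⟩
    cell (suc k) 0                      ∎
    where open ≡-Reasoning
  walk k (suc r) r<Q = begin
    iter f (k * Q + suc r) (cell 0 0)   ≡⟨ cong (λ t → iter f t (cell 0 0)) (+-suc (k * Q) r) ⟩
    f (iter f (k * Q + r) (cell 0 0))   ≡⟨ cong f (walk k r (<⇒≤ r<Q)) ⟩
    f (cell k r)                        ≡⟨ along k r r<Q ⟩
    cell k (suc r)                      ∎
    where open ≡-Reasoning

  cycle : ∀ x y → ∃ λ t → iter f t x ≡ y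
  cycle = single-cycle f (cell 0 0) (P * Q) period onto
    where
    period : iter f (P * Q) (cell 0 0) ≡ cell 0 0
    period = trans (cong (λ t → iter f t (cell 0 0)) (sym (+-identityʳ (P * Q))))
                   (trans (walk P 0 z≤n) closed)

    onto : ∀ y → ∃ λ t → t < P * Q × iter f t (cell 0 0) ≡ y
    onto y with covers y
    ... | k , r , k<P , r<Q , e =
      k * Q + r ,
      ≤-trans (+-monoʳ-< (k * Q) r<Q) (≤-trans (≤-reflexive (+-comm (k * Q) Q)) (*-monoˡ-≤ Q k<P)) ,
      trans (walk k r (<⇒≤ r<Q)) e

zigzag : ∀ N M .{{_ : NonZero N}} .{{_ : NonZero M}} → ℕ → ℕ → Fin N × Fin M
zigzag N M k r = r mod N , (k + r % 2) mod M

module _ (N M : ℕ) .{{_ : NonZero N}} .{{_ : NonZero M}} where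

  zigzag-wrap : N % 2 ≡ 1 → ∀ k → zigzag N M k N ≡ zigzag N M (suc k) 0
  zigzag-wrap odd k = cong₂ _,_ (mod-self N)
    (cong (_mod M) (trans (cong (k +_) odd) (trans (+-comm k 1) (sym (+-identityʳ (suc k))))))

  zigzag-closed : zigzag N M M 0 ≡ zigzag N M 0 0
  zigzag-closed = cong (0 mod N ,_) (trans (cong (_mod M) (+-identityʳ M)) (mod-self M))

  zigzag-covers : ∀ y → ∃ λ k → ∃ λ r → k < M × r < N × zigzag N M k r ≡ y
  zigzag-covers (a , b) with mod-onto M b (toℕ a % 2) (≤-trans (s≤s⁻¹ (m%n<n (toℕ a) 2)) (>-nonZero⁻¹ M))
  ... | k , k<M , e = k , toℕ a , k<M , toℕ<n a , cong₂ _,_ (mod-toℕ a) e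

module OddSide {n m : ℕ} .{{_ : NonZero n}} .{{_ : NonZero m}}
               (A : Array n m) (full : TotallyFilled A) where
  open TotallyFilledMoves A full

  oddRows : n % 2 ≡ 1 → HasSolution A
  oddRows odd = R , C , λ x y _ _ → GridWalk.cycle (move A R C) (zigzag n m) m n along
                  (zigzag-wrap n m odd) (zigzag-closed n m) (zigzag-covers n m) x y
    where
    R : Fin n → Sign
    R i = alternate (toℕ i % 2)
    C : Fin m → Sign
    C _ = Sign.+

    along : ∀ k r → r < n → move A R C (zigzag n m k r) ≡ zigzag n m k (suc r)
    along k r r<n = trans (move-full R C _ _) (cong₂ _,_ (step+-mod r n)
      (trans (cong (λ z → step (alternate (z % 2)) ((k + r % 2) mod m)) (toℕ-mod-< r<n))
             (step-alternate k r m)))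

  oddColumns : m % 2 ≡ 1 → HasSolution A
  oddColumns odd = R , C , λ x y _ _ → GridWalk.cycle (move A R C) cell n m along
                     (λ k → cong swap (zigzag-wrap m n odd k)) (cong swap (zigzag-closed m n))
                     covers x y
    where
    R : Fin n → Sign
    R _ = Sign.+
    C : Fin m → Sign
    C j = alternate (toℕ (step Sign.- j) % 2)

    cell : ℕ → ℕ → Cell n m
    cell k r = swap (zigzag m n k r)

    along : ∀ k r → r < m → move A R C (cell k r) ≡ cell k (suc r)
    along k r r<m = begin
      move A R C (row , r mod m)                    ≡⟨ move-full R C row (r mod m) ⟩
      (step (C next) row , next)                    ≡⟨ cong (λ j → step (C j) row , j) (step+-mod r m) ⟩
      (step (C (suc r mod m)) row , suc r mod m)    ≡⟨ cong (λ j → step (alternate (toℕ j % 2)) row , suc r mod m) (step--mod r m) ⟩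
      (step (alternate (toℕ (r mod m) % 2)) row , suc r mod m)
                                                    ≡⟨ cong (λ z → step (alternate (z % 2)) row , suc r mod m) (toℕ-mod-< r<m) ⟩
      (step (alternate (r % 2)) row , suc r mod m)  ≡⟨ cong (_, suc r mod m) (step-alternate k r n) ⟩
      cell k (suc r)                                ∎
      where
      open ≡-Reasoning
      row = (k + r % 2) mod n
      next = step Sign.+ (r mod m)

    covers : ∀ y → ∃ λ k → ∃ λ r → k < n × r < m × cell k r ≡ y
    covers (a , b) with zigzag-covers m n (b , a)
    ... | k , r , k<n , r<m , e = k , r , k<n , r<m , cong swap e

colour : ∀ {n m} → Cell n m → ℕ
colour (i , j) = (toℕ i + toℕ j) % 2

module EvenSides {n m : ℕ} .{{_ : NonZero n}} .{{_ : NonZero m}}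
                 (A : Array n m) (full : TotallyFilled A) (2∣n : 2 ∣ n) (2∣m : 2 ∣ m) where
  open TotallyFilledMoves A full

  sum-row-step : ∀ a s j → (a + toℕ (step s j)) % 2 ≡ suc (a + toℕ j) % 2
  sum-row-step a s j = begin
    (a + toℕ (step s j)) % 2            ≡⟨ %-distribˡ-+ a _ 2 ⟩
    (a % 2 + toℕ (step s j) % 2) % 2    ≡⟨ cong (λ b → (a % 2 + b) % 2) (step-parity m 2∣m s j) ⟩
    (a % 2 + suc (toℕ j) % 2) % 2       ≡⟨ %-distribˡ-+ a _ 2 ⟨
    (a + suc (toℕ j)) % 2               ≡⟨ cong (_% 2) (+-suc a (toℕ j)) ⟩
    suc (a + toℕ j) % 2                 ∎
    where open ≡-Reasoning

  -- A move (one column step, one row step) changes the parity twice,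
  -- so it preserves the colour.
  colour-move : ∀ R C x → colour (move A R C x) ≡ colour x
  colour-move R C (i , j) = begin
    colour (move A R C (i , j))                   ≡⟨ cong colour (move-full R C i j) ⟩
    (toℕ (step c i) + toℕ j') % 2                 ≡⟨ %-distribˡ-+ (toℕ (step c i)) _ 2 ⟩
    (toℕ (step c i) % 2 + toℕ j' % 2) % 2         ≡⟨ cong (λ a → (a + toℕ j' % 2) % 2) (step-parity n 2∣n c i) ⟩
    (suc (toℕ i) % 2 + toℕ j' % 2) % 2            ≡⟨ %-distribˡ-+ (suc (toℕ i)) _ 2 ⟨
    (suc (toℕ i) + toℕ j') % 2                    ≡⟨ sum-row-step (suc (toℕ i)) (R i) j ⟩
    (toℕ i + toℕ j) % 2                           ∎
    where
    open ≡-Reasoning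
    j' = step (R i) j
    c = C j'

  colour-iter : ∀ R C t x → colour (iter (move A R C) t x) ≡ colour x
  colour-iter R C zero x = refl
  colour-iter R C (suc t) x = trans (colour-move R C _) (colour-iter R C t x)

  -- (i , j) and its row neighbour (i , j + 1) have different colours,
  -- so the first never reaches the second.
  unreachable : ∀ R C t i j → iter (move A R C) t (i , j) ≢ (i , step Sign.+ j)
  unreachable R C t i j reached = parity-flip (toℕ i + toℕ j)
    (trans (sym (colour-iter R C t (i , j))) (trans (cong colour reached) (sum-row-step (toℕ i) Sign.+ j)))

  no-solution : ¬ HasSolution A
  no-solution (R , C , solution) =
    let t , reached = solution (i , j) (i , step Sign.+ j) (full _ _) (full _ _)
    in unreachable R C t i j reached
    where
    i = 0 mod n
    j = 0 mod m

theorem3p3 : (n m : ℕ) .{{_ : NonZero n}} .{{_ : NonZero m}} (A : Array n m) →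
             TotallyFilled A → (HasSolution A ⇔ (¬ ((2 ∣ n) × (2 ∣ m))))
theorem3p3 n m A full = mk⇔ (λ solution (2∣n , 2∣m) → EvenSides.no-solution A full 2∣n 2∣m solution)
                            oneOdd
  where
  oneOdd : ¬ ((2 ∣ n) × (2 ∣ m)) → HasSolution A
  oneOdd notBothEven with parity n | parity m
  ... | inj₂ (n-odd , _) | _ = OddSide.oddRows A full n-odd
  ... | inj₁ _ | inj₂ (m-odd , _) = OddSide.oddColumns A full m-odd
  ... | inj₁ (n-even , _) | inj₁ (m-even , _) = ⊥-elim (notBothEven (m%n≡0⇒n∣m n 2 n-even , m%n≡0⇒n∣m m 2 m-even))
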